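{- For all positive integers $a,d$, the distributive lattice $J(P_{a,1,1,d})$ is tCDE with edge density one.
   Context: $P_{a,1,1,d}$ is the poset with elements $w_1,\dots,w_a,x_1,y_1,z_1,\dots,z_d$ whose order is generated by the cover relations $w_i\lessdot w_{i+1}$ ($1\le i<a$), $w_a\lessdot x_1$, $w_a\lessdot y_1$, $x_1\lessdot z_1$, $y_1\lessdot z_1$, $z_i\lessdot z_{i+1}$ ($1\le i<d$). $J(P)$ is the set of order ideals of $P$ under inclusion; $\mathrm{ddeg}(I)$ is the number of elements covered by $I$; $\mathrm{uni}$ is uniform; edge density is $\mathbb{E}(\mathrm{uni};\mathrm{ddeg})$. For $I\in J(P)$, $p\in P$: $\mathcal{T}^+_p(I)=1$ if $p\notin I$ and $p$ minimal in $P\setminus I$, else 0; $\mathcal{T}^-_p(I)=1$ if $p\in I$ maximal in $I$, else 0. A distribution $\mu$ on $J(P)$ is toggle-symmetric if $\mathbb{E}(\mu;\mathcal{T}^+_p)=\mathbb{E}(\mu;\mathcal{T}^-_p)$ for all $p$; $J(P)$ is tCDE if $\mathbb{E}(\mu;\mathrm{ddeg})=\mathbb{E}(\mathrm{uni};\mathrm{ddeg})$ for all toggle-symmetric $\mu$.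
   Formalization: In the definition of tCDE, the toggle-symmetric distributions μ on $J(P_{a,1,1,d})$ take only rational values. -}

module Defs where

open import Data.Nat using (ℕ; zero; suc; NonZero; _≤ᵇ_)
open import Data.Fin using (Fin; toℕ)
open import Data.Fin.Properties using () renaming (_≟_ to _≟F_)
open import Data.List using (List; []; _∷_; _++_; map; concatMap; filter; length; foldr; allFin)
open import Data.Bool.ListAction using (all; any)
open import Data.Bool using (Bool; true; false; _∧_; _∨_; not; T; if_then_else_)
open import Data.Product using (Σ; _,_; proj₁)
open import Data.Integer using (+_)
open import Data.Rational using (ℚ; 0ℚ; _+_; _*_; _/_; _≤_)
open import Relation.Nullary.Decidable using (⌊_⌋)
open import Relation.Binary.PropositionalEquality using (_≡_; refl; cong)

-- The poset P_{a,1,1,d}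
-- Elements: w_1..w_a (w i, i : Fin a, w zero = w_1), x_1 (x), y_1 (y),
-- z_1..z_d (z j, j : Fin d, z zero = z_1).

data Elem (a d : ℕ) : Set where
  w : Fin a → Elem a d
  x : Elem a d
  y : Elem a d
  z : Fin d → Elem a d

module _ {a d : ℕ} where

  _==E_ : Elem a d → Elem a d → Bool
  w i ==E w j = ⌊ i ≟F j ⌋
  x ==E x = true
  y ==E y = true
  z i ==E z j = ⌊ i ≟F j ⌋
  _ ==E _ = false

  -- The order of P_{a,1,1,d}: the reflexive-transitive closure of the cover
  -- relations w_i ⋖ w_{i+1}, w_a ⋖ x_1, w_a ⋖ y_1, x_1 ⋖ z_1, y_1 ⋖ z_1,
  -- z_i ⋖ z_{i+1}, written out explicitly.
  leq : Elem a d → Elem a d → Bool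
  leq (w i) (w j) = toℕ i ≤ᵇ toℕ j
  leq (w i) x = true
  leq (w i) y = true
  leq (w i) (z j) = true
  leq x x = true
  leq x (z j) = true
  leq y y = true
  leq y (z j) = true
  leq (z i) (z j) = toℕ i ≤ᵇ toℕ j
  leq _ _ = false

  lt : Elem a d → Elem a d → Bool
  lt p q = leq p q ∧ not (p ==E q)

elems : (a d : ℕ) → List (Elem a d)
elems a d = map w (allFin a) ++ (x ∷ y ∷ map z (allFin d))

Sub : ℕ → ℕ → Set
Sub a d = Elem a d → Bool

allSubs : {a d : ℕ} → List (Elem a d) → List (Sub a d)
allSubs [] = (λ _ → false) ∷ []
allSubs (e ∷ es) = concatMap (λ S → S ∷ (λ u → (u ==E e) ∨ S u) ∷ []) (allSubs es)

isIdeal : {a d : ℕ} → Sub a d → Bool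
isIdeal {a} {d} S =
  all (λ q → all (λ p → not (S q ∧ leq p q) ∨ S p) (elems a d)) (elems a d)

J : ℕ → ℕ → Set
J a d = Σ (Sub a d) (λ S → isIdeal S ≡ true)

keep : {a d : ℕ} (S : Sub a d) (b : Bool) → isIdeal S ≡ b → List (J a d) → List (J a d)
keep S true e r = (S , e) ∷ r
keep S false _ r = r

collect : {a d : ℕ} → List (Sub a d) → List (J a d)
collect [] = []
collect (S ∷ Ss) = keep S (isIdeal S) refl (collect Ss)

ideals : (a d : ℕ) → List (J a d)
ideals a d = collect (allSubs (elems a d))

module _ {a d : ℕ} where

  ⊆ᵇ : Sub a d → Sub a d → Bool
  ⊆ᵇ S T' = all (λ p → not (S p) ∨ T' p) (elems a d)

  ⊂ᵇ : Sub a d → Sub a d → Bool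
  ⊂ᵇ S T' = ⊆ᵇ S T' ∧ not (⊆ᵇ T' S)

  coveredBy : J a d → J a d → Bool
  coveredBy I' I =
    ⊂ᵇ (proj₁ I') (proj₁ I) ∧
    not (any (λ K → ⊂ᵇ (proj₁ I') (proj₁ K) ∧ ⊂ᵇ (proj₁ K) (proj₁ I)) (ideals a d))

  ddeg : J a d → ℕ
  ddeg I = length (filter (λ I' → coveredBy I' I ≡? true) (ideals a d))
    where
      open import Data.Bool.Properties using () renaming (_≟_ to _≡?_)

  Tplus : Elem a d → J a d → ℕ
  Tplus p I = if not (proj₁ I p) ∧ all (λ q → not (lt q p) ∨ proj₁ I q) (elems a d)
              then 1 else 0

  Tminus : Elem a d → J a d → ℕ
  Tminus p I = if proj₁ I p ∧ all (λ q → not (lt p q) ∨ not (proj₁ I q)) (elems a d)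
               then 1 else 0

ℕtoℚ : ℕ → ℚ
ℕtoℚ n = (+ n) / 1

module _ {a d : ℕ} where

  sumJ : (J a d → ℚ) → ℚ
  sumJ f = foldr (λ I acc → f I + acc) 0ℚ (ideals a d)

  IsDistribution : (J a d → ℚ) → Set
  IsDistribution μ = ((I : J a d) → 0ℚ ≤ μ I) Data.Product.× (sumJ μ ≡ Data.Rational.1ℚ)

  E : (J a d → ℚ) → (J a d → ℕ) → ℚ
  E μ f = sumJ (λ I → μ I * ℕtoℚ (f I))

  IsToggleSymmetric : (J a d → ℚ) → Set
  IsToggleSymmetric μ = (p : Elem a d) → E μ (Tplus p) ≡ E μ (Tminus p)

-- |J(P)| is nonzero (the empty set is an ideal); needed for the uniform
-- distribution.

private
  allT : {A : Set} (f : A → Bool) → ((u : A) → f u ≡ true) →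
         (l : List A) → all f l ≡ true
  allT f h [] = refl
  allT f h (u ∷ l) rewrite h u = allT f h l

  emptyIdeal : {a d : ℕ} → isIdeal {a} {d} (λ _ → false) ≡ true
  emptyIdeal {a} {d} = allT _ (λ q → allT _ (λ p → refl) (elems a d)) (elems a d)

  data Head {a d : ℕ} : List (Sub a d) → Set where
    head∅ : (r : List (Sub a d)) → Head ((λ _ → false) ∷ r)

  allSubsHead : {a d : ℕ} (es : List (Elem a d)) → Head (allSubs es)
  allSubsHead [] = head∅ []
  allSubsHead (e ∷ es) with allSubs es | allSubsHead es
  ... | _ | head∅ r = head∅ _

  keepNZ : {a d : ℕ} (S : Sub a d) (b : Bool) (e : isIdeal S ≡ b) (r : List (J a d)) →
           b ≡ true → NonZero (length (keep S b e r))
  keepNZ S true e r _ = _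

  collectNZ : {a d : ℕ} (l : List (Sub a d)) → Head l → NonZero (length (collect l))
  collectNZ {a} {d} _ (head∅ r) =
    keepNZ (λ _ → false) (isIdeal {a} {d} (λ _ → false)) refl (collect r) (emptyIdeal {a} {d})

instance
  idealsNonZero : {a d : ℕ} → NonZero (length (ideals a d))
  idealsNonZero {a} {d} = collectNZ {a} {d} (allSubs (elems a d)) (allSubsHead (elems a d))

uni : {a d : ℕ} → J a d → ℚ
uni {a} {d} _ = _/_ (+ 1) (length (ideals a d)) {{idealsNonZero {a} {d}}}

edgeDensity : (a d : ℕ) → ℚ
edgeDensity a d = E {a} {d} (uni {a} {d}) (ddeg {a} {d})

IsTCDE : (a d : ℕ) → Set
IsTCDE a d = (μ : J a d → ℚ) → IsDistribution μ → IsToggleSymmetric μ →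
             E μ (ddeg {a} {d}) ≡ E (uni {a} {d}) (ddeg {a} {d})

-- An order ideal I of P = P_{a,1,1,d} covers exactly the ideals I ∖ {p} with p maximal
-- in I, so ddeg = Σ_p T⁻_p.  Along the chain w_1 < … < w_a at most one element is
-- minimal outside I, and one is iff some w_i ∉ I; dually along z_1 < … < z_d at most
-- one element is maximal in I, and one is iff some z_j ∈ I.  A case check on x_1, y_1
-- then gives, for every I,
--   2 ddeg(I) + Σ_p c_p T⁺_p(I) = 2 + Σ_p c_p T⁻_p(I),   c = 2 on w, 1 on x_1, y_1, 0 on z.
-- Taking expectations, the toggle terms cancel for every toggle-symmetric μ, so
-- E(μ; ddeg) = 1.  The uniform distribution is toggle-symmetric because I ↦ I ∪ {p}
-- is a bijection from the ideals having p minimal outside to those having p maximal.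

module Submission where

open import Defs
open import Data.Nat using (ℕ; _≥_)
open import Data.Product using (_×_)
open import Data.Rational using (1ℚ)
open import Relation.Binary.PropositionalEquality using (_≡_)

open import Algebra.Bundles using (CommutativeSemiring; CommutativeRing)
open import Data.Bool using (Bool; true; false; _∧_; _∨_; not; T; if_then_else_)
open import Data.Bool.ListAction using (all; any; and)
import Data.Bool.Properties as 𝔹
open import Data.Empty using (⊥-elim)
open import Data.Fin as Fin using (Fin; toℕ)
import Data.Fin.Properties as Finₚ
open import Data.Integer as ℤ using (+_)
import Data.Integer.Properties as ℤ
open import Data.List using (List; []; _∷_; _++_; map; foldr; filter; length; concatMap; allFin)
import Data.List.Properties as Listₚ
open import Data.List.Membership.Propositional using (_∈_; _∉_)
open import Data.List.Membership.Propositional.Properties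
  using (∈-map⁺; ∈-map⁻; ∈-++⁺ˡ; ∈-++⁺ʳ; ∈-allFin)
open import Data.List.Relation.Unary.All as All using (All; []; _∷_)
open import Data.List.Relation.Unary.All.Properties using (¬All⇒Any¬)
open import Data.List.Relation.Unary.Any as Any using (Any; here; there)
import Data.List.Relation.Unary.AllPairs as AllPairs
open import Data.List.Relation.Unary.Unique.Propositional using (Unique)
import Data.List.Relation.Unary.Unique.Propositional.Properties as Uniqueₚ
open import Data.Nat.Coprimality using (1-coprimeTo) renaming (sym to coprime-sym)
open import Data.Nat.Induction using (<-wellFounded)
import Data.Nat.Properties as ℕ
open import Data.Product using (_,_; proj₁; proj₂; ∃-syntax)
open import Data.Rational as ℚ using (ℚ; mkℚ)
import Data.Rational.Properties as ℚ
import Data.Rational.Unnormalised as ℚᵘ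
import Data.Rational.Unnormalised.Properties as ℚᵘ
open import Data.Sum using (_⊎_; inj₁; inj₂; [_,_])
open import Data.Unit using (tt)
open import Function using (_∘_; id; case_of_)
open import Induction.WellFounded using (Acc; acc)
open import Relation.Binary.Definitions using (DecidableEquality)
open import Relation.Binary.PropositionalEquality
  using (_≢_; _≗_; refl; sym; trans; cong; cong₂; subst; module ≡-Reasoning)
open import Relation.Nullary using (¬_; Reflects; ofʸ; ofⁿ; Dec; _because_; yes; no)
open import Relation.Nullary.Decidable using (does; ⌊_⌋; ⌊⌋-map′; dec-true; T?)
open import Relation.Nullary.Reflects
  using (_×-reflects_; _⊎-reflects_; _→-reflects_; ¬-reflects; T-reflects; det)
open import Algebra.Properties.Group ℚ.+-0-group using (∙-cancelʳ)
open import Algebra.Properties.CommutativeSemigroup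
  (CommutativeRing.*-commutativeSemigroup ℚ.+-*-commutativeRing) using (x∙yz≈y∙xz)

-- Finite sums

module BigSum {c ℓ} (R : CommutativeSemiring c ℓ) where
  open CommutativeSemiring R renaming (refl to ≈-refl; sym to ≈-sym; trans to ≈-trans)
  open import Algebra.Properties.CommutativeSemigroup +-commutativeSemigroup using (interchange)

  ∑ : {A : Set} → List A → (A → Carrier) → Carrier
  ∑ l f = foldr (λ u acc → f u + acc) 0# l

  module _ {A : Set} where

    ∑-cong : (l : List A) {f g : A → Carrier} → (∀ u → f u ≈ g u) → ∑ l f ≈ ∑ l g
    ∑-cong []      f≈g = ≈-refl
    ∑-cong (u ∷ l) f≈g = +-cong (f≈g u) (∑-cong l f≈g)

    ∑-cong-All : {P : A → Set} {l : List A} {f g : A → Carrier} →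
                 All P l → (∀ u → P u → f u ≈ g u) → ∑ l f ≈ ∑ l g
    ∑-cong-All []        f≈g = ≈-refl
    ∑-cong-All (pu ∷ pl) f≈g = +-cong (f≈g _ pu) (∑-cong-All pl f≈g)

    ∑-zero : (l : List A) {f : A → Carrier} → (∀ u → f u ≈ 0#) → ∑ l f ≈ 0#
    ∑-zero []      f≈0 = ≈-refl
    ∑-zero (u ∷ l) f≈0 = ≈-trans (+-cong (f≈0 u) (∑-zero l f≈0)) (+-identityˡ 0#)

    ∑-++ : (l m : List A) (f : A → Carrier) → ∑ (l ++ m) f ≈ ∑ l f + ∑ m f
    ∑-++ []      m f = ≈-sym (+-identityˡ (∑ m f))
    ∑-++ (u ∷ l) m f = ≈-trans (+-congˡ (∑-++ l m f)) (≈-sym (+-assoc (f u) (∑ l f) (∑ m f)))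

    ∑-distrib-+ : (l : List A) (f g : A → Carrier) → ∑ l (λ u → f u + g u) ≈ ∑ l f + ∑ l g
    ∑-distrib-+ []      f g = ≈-sym (+-identityˡ 0#)
    ∑-distrib-+ (u ∷ l) f g =
      ≈-trans (+-congˡ (∑-distrib-+ l f g)) (interchange (f u) (g u) (∑ l f) (∑ l g))

    ∑-distribˡ-* : (l : List A) (k : Carrier) (f : A → Carrier) → ∑ l (λ u → k * f u) ≈ k * ∑ l f
    ∑-distribˡ-* []      k f = ≈-sym (zeroʳ k)
    ∑-distribˡ-* (u ∷ l) k f =
      ≈-trans (+-congˡ (∑-distribˡ-* l k f)) (≈-sym (distribˡ k (f u) (∑ l f)))

  module _ {A B : Set} where

    ∑-map : (h : A → B) (l : List A) (f : B → Carrier) → ∑ (map h l) f ≈ ∑ l (f ∘ h)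
    ∑-map h []      f = ≈-refl
    ∑-map h (u ∷ l) f = +-congˡ (∑-map h l f)

    ∑-swap : (l : List A) (m : List B) (f : A → B → Carrier) →
             ∑ l (λ u → ∑ m (f u)) ≈ ∑ m (λ v → ∑ l (λ u → f u v))
    ∑-swap []      m f = ≈-sym (∑-zero m (λ _ → ≈-refl))
    ∑-swap (u ∷ l) m f =
      ≈-trans (+-congˡ (∑-swap l m f)) (≈-sym (∑-distrib-+ m (f u) (λ v → ∑ l (λ u → f u v))))

-- Imported only here: inside BigSum these names would clash with the semiring operations.
open import Data.Nat using (zero; suc; _+_; _*_; _∸_; _≤_; _<_; s≤s; _≤ᵇ_; NonZero)

open BigSum ℕ.+-*-commutativeSemiring

-- Booleans and reflection

reflects-map : {P Q : Set} {b : Bool} → (P → Q) → (Q → P) → Reflects P b → Reflects Q b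
reflects-map f g (ofʸ p)  = ofʸ (f p)
reflects-map f g (ofⁿ ¬p) = ofⁿ (¬p ∘ g)

toWitnessᴿ : {P : Set} {b : Bool} → Reflects P b → T b → P
toWitnessᴿ (ofʸ p) _ = p

fromWitnessᴿ : {P : Set} {b : Bool} → Reflects P b → P → T b
fromWitnessᴿ (ofʸ _)  _ = _
fromWitnessᴿ (ofⁿ ¬p) p = ¬p p

reflects-≡ : {P Q : Set} {b c : Bool} → (P → Q) → (Q → P) → Reflects P b → Reflects Q c → b ≡ c
reflects-≡ f g rp rq = det (reflects-map f g rp) rq

reflects-stable : {P : Set} {b : Bool} → Reflects P b → ¬ ¬ P → P
reflects-stable (ofʸ p)  _   = p
reflects-stable (ofⁿ ¬p) ¬¬p = ⊥-elim (¬¬p ¬p)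

reflects-¬→ : {P Q : Set} {b : Bool} → Reflects P b → ¬ (P → Q) → P × ¬ Q
reflects-¬→ (ofʸ p)  ¬[p→q] = p , λ q → ¬[p→q] (λ _ → q)
reflects-¬→ (ofⁿ ¬p) ¬[p→q] = ⊥-elim (¬[p→q] (λ p → ⊥-elim (¬p p)))

T-ext : {b c : Bool} → (T b → T c) → (T c → T b) → b ≡ c
T-ext {b} {c} f g = reflects-≡ f g (T-reflects b) (T-reflects c)

module _ {A : Set} {P : A → Set} {f : A → Bool} (P? : ∀ u → Reflects (P u) (f u)) where

  all-reflects : (l : List A) → Reflects (All P l) (all f l)
  all-reflects []      = ofʸ []
  all-reflects (u ∷ l) with f u | P? u
  ... | false | ofⁿ ¬pu = ofⁿ (¬pu ∘ All.head)
  ... | true  | ofʸ pu  = reflects-map (pu ∷_) All.tail (all-reflects l)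

  any-reflects : (l : List A) → Reflects (Any P l) (any f l)
  any-reflects []      = ofⁿ λ ()
  any-reflects (u ∷ l) with f u | P? u
  ... | true  | ofʸ pu  = ofʸ (here pu)
  ... | false | ofⁿ ¬pu =
    reflects-map there (λ { (here pu) → ⊥-elim (¬pu pu) ; (there pl) → pl }) (any-reflects l)

all-allFin-reflects : {n : ℕ} {P : Fin n → Set} {f : Fin n → Bool} →
                      (∀ i → Reflects (P i) (f i)) → Reflects (∀ i → P i) (all f (allFin n))
all-allFin-reflects {n} {P} P? =
  reflects-map (λ h i → All.lookup h (∈-allFin i)) (λ h → All.tabulate (λ {i} _ → h i))
               (all-reflects {P = P} P? (allFin n))

𝟙 : Bool → ℕ
𝟙 b = if b then 1 else 0

𝟙-T : {b : Bool} → T b → 𝟙 b ≡ 1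
𝟙-T {true} _ = refl

𝟙-¬T : {b : Bool} → ¬ T b → 𝟙 b ≡ 0
𝟙-¬T {false} _  = refl
𝟙-¬T {true}  ¬t = ⊥-elim (¬t _)

module _ {A : Set} where

  ∑-𝟙-false : (l : List A) {f : A → Bool} → (∀ u → ¬ T (f u)) → ∑ l (𝟙 ∘ f) ≡ 0
  ∑-𝟙-false l ¬f = ∑-zero l (𝟙-¬T ∘ ¬f)

  ∑-𝟙⇒Any : (l : List A) {f : A → Bool} → ∑ l (𝟙 ∘ f) ≢ 0 → Any (T ∘ f) l
  ∑-𝟙⇒Any []      ∑≢0 = ⊥-elim (∑≢0 refl)
  ∑-𝟙⇒Any (u ∷ l) {f} ∑≢0 with f u in fu≡b
  ... | true  = here (subst T (sym fu≡b) tt)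
  ... | false = there (∑-𝟙⇒Any l ∑≢0)

  ∑-pairs : (g : A → A) (l : List A) (f : A → ℕ) →
            ∑ (concatMap (λ u → u ∷ g u ∷ []) l) f ≡ ∑ l (λ u → f u + f (g u))
  ∑-pairs g []      f = refl
  ∑-pairs g (u ∷ l) f =
    trans (cong (λ s → f u + (f (g u) + s)) (∑-pairs g l f)) (sym (ℕ.+-assoc (f u) (f (g u)) _))

  length-filter : (l : List A) (f : A → Bool) →
                  length (filter (λ v → f v 𝔹.≟ true) l) ≡ ∑ l (𝟙 ∘ f)
  length-filter []      f = refl
  length-filter (u ∷ l) f with f u
  ... | true  = cong suc (length-filter l f)
  ... | false = length-filter l f

module _ {A : Set} (_≟_ : DecidableEquality A) where

  ∑-𝟙-≟-∉ : (l : List A) {u : A} → u ∉ l → ∑ l (λ v → 𝟙 (does (v ≟ u))) ≡ 0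
  ∑-𝟙-≟-∉ []      u∉l = refl
  ∑-𝟙-≟-∉ (v ∷ l) {u} u∉l with v ≟ u
  ... | yes refl = ⊥-elim (u∉l (here refl))
  ... | no  _    = ∑-𝟙-≟-∉ l (u∉l ∘ there)

  ∑-𝟙-≟-unique : {l : List A} {u : A} → Unique l → u ∈ l → ∑ l (λ v → 𝟙 (does (v ≟ u))) ≡ 1
  ∑-𝟙-≟-unique {v ∷ l} ul (here refl) rewrite dec-true (v ≟ v) refl =
    cong suc (∑-𝟙-≟-∉ l (Uniqueₚ.Unique[x∷xs]⇒x∉xs ul))
  ∑-𝟙-≟-unique {v ∷ l} {u} ul@(_ AllPairs.∷ ul′) (there u∈l) with v ≟ u
  ... | yes refl = ⊥-elim (Uniqueₚ.Unique[x∷xs]⇒x∉xs ul u∈l)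
  ... | no  _    = ∑-𝟙-≟-unique ul′ u∈l

-- The poset P_{a,1,1,d}

module _ {a d : ℕ} where

  ==E-reflects : (u v : Elem a d) → Reflects (u ≡ v) (u ==E v)
  ==E-reflects (w i) (w j) with i Finₚ.≟ j
  ... | yes refl = ofʸ refl
  ... | no  i≢j  = ofⁿ λ { refl → i≢j refl }
  ==E-reflects (z i) (z j) with i Finₚ.≟ j
  ... | yes refl = ofʸ refl
  ... | no  i≢j  = ofⁿ λ { refl → i≢j refl }
  ==E-reflects x     x     = ofʸ refl
  ==E-reflects y     y     = ofʸ refl
  ==E-reflects (w _) x     = ofⁿ λ ()
  ==E-reflects (w _) y     = ofⁿ λ ()
  ==E-reflects (w _) (z _) = ofⁿ λ ()
  ==E-reflects x     (w _) = ofⁿ λ ()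
  ==E-reflects x     y     = ofⁿ λ ()
  ==E-reflects x     (z _) = ofⁿ λ ()
  ==E-reflects y     (w _) = ofⁿ λ ()
  ==E-reflects y     x     = ofⁿ λ ()
  ==E-reflects y     (z _) = ofⁿ λ ()
  ==E-reflects (z _) (w _) = ofⁿ λ ()
  ==E-reflects (z _) x     = ofⁿ λ ()
  ==E-reflects (z _) y     = ofⁿ λ ()

  _≟E_ : DecidableEquality (Elem a d)
  u ≟E v = (u ==E v) because ==E-reflects u v

  ∈-elems : (u : Elem a d) → u ∈ elems a d
  ∈-elems (w i) = ∈-++⁺ˡ (∈-map⁺ w (∈-allFin i))
  ∈-elems x     = ∈-++⁺ʳ _ (here refl)
  ∈-elems y     = ∈-++⁺ʳ _ (there (here refl))
  ∈-elems (z j) = ∈-++⁺ʳ _ (there (there (∈-map⁺ z (∈-allFin j))))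

  elems-unique : Unique (elems a d)
  elems-unique = Uniqueₚ.++⁺ (Uniqueₚ.map⁺ (λ { refl → refl }) (Uniqueₚ.allFin⁺ a))
    (((λ ()) ∷ All.tabulate (x≢z ∘ ∈-map⁻ z)) AllPairs.∷
     All.tabulate (y≢z ∘ ∈-map⁻ z) AllPairs.∷
     Uniqueₚ.map⁺ (λ { refl → refl }) (Uniqueₚ.allFin⁺ d))
    w-disjoint
    where
    x≢z : ∀ {v} → ∃[ j ] (j ∈ allFin d × v ≡ z j) → x ≢ v
    x≢z (_ , _ , refl) ()
    y≢z : ∀ {v} → ∃[ j ] (j ∈ allFin d × v ≡ z j) → y ≢ v
    y≢z (_ , _ , refl) ()
    w-disjoint : ∀ {v} → v ∈ map w (allFin a) × v ∈ x ∷ y ∷ map z (allFin d) → _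
    w-disjoint (v∈w , v∈xyz) with ∈-map⁻ w v∈w
    ... | _ , _ , refl with v∈xyz
    ...   | there (there v∈z) with ∈-map⁻ z v∈z
    ...     | _ , _ , ()

  ∑-elems-==E : (p : Elem a d) → ∑ (elems a d) (λ q → 𝟙 (q ==E p)) ≡ 1
  ∑-elems-==E p = ∑-𝟙-≟-unique _≟E_ elems-unique (∈-elems p)

  ∑-elems : (f : Elem a d → ℕ) →
            ∑ (elems a d) f ≡ ∑ (allFin a) (f ∘ w) + (f x + (f y + ∑ (allFin d) (f ∘ z)))
  ∑-elems f = trans (∑-++ (map w (allFin a)) (x ∷ y ∷ map z (allFin d)) f)
    (cong₂ _+_ (∑-map w (allFin a) f) (cong (λ s → f x + (f y + s)) (∑-map z (allFin d) f)))

  all-elems-reflects : {P : Elem a d → Set} {f : Elem a d → Bool} →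
                       (∀ u → Reflects (P u) (f u)) → Reflects (∀ u → P u) (all f (elems a d))
  all-elems-reflects {P} P? =
    reflects-map (λ h u → All.lookup h (∈-elems u)) (λ h → All.tabulate (λ {u} _ → h u))
                 (all-reflects {P = P} P? (elems a d))

  ¬∀⇒∃¬ : {P : Elem a d → Set} {f : Elem a d → Bool} →
          (∀ u → Reflects (P u) (f u)) → ¬ (∀ u → P u) → ∃[ u ] ¬ P u
  ¬∀⇒∃¬ {f = f} P? ¬∀ = Any.satisfied
    (¬All⇒Any¬ (λ u → f u because P? u) (elems a d) (λ h → ¬∀ (λ u → All.lookup h (∈-elems u))))

  lt-reflects : (p q : Elem a d) → Reflects (T (leq p q) × p ≢ q) (lt p q)
  lt-reflects p q = T-reflects (leq p q) ×-reflects ¬-reflects (==E-reflects p q)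

  rank : Elem a d → ℕ
  rank (w i) = toℕ i
  rank x     = a
  rank y     = a
  rank (z j) = suc (a + toℕ j)

  rank-≤ : (u : Elem a d) → rank u ≤ a + d
  rank-≤ (w i) = ℕ.≤-trans (ℕ.<⇒≤ (Finₚ.toℕ<n i)) (ℕ.m≤m+n a d)
  rank-≤ x     = ℕ.m≤m+n a d
  rank-≤ y     = ℕ.m≤m+n a d
  rank-≤ (z j) = subst (_≤ a + d) (ℕ.+-suc a (toℕ j)) (ℕ.+-monoʳ-≤ a (Finₚ.toℕ<n j))

  private
    toℕ-< : {n : ℕ} {i j : Fin n} → T (toℕ i ≤ᵇ toℕ j) → i ≢ j → toℕ i < toℕ j
    toℕ-< {i = i} {j} i≤j i≢j =
      ℕ.≤∧≢⇒< (ℕ.≤ᵇ⇒≤ (toℕ i) (toℕ j) i≤j) (i≢j ∘ Finₚ.toℕ-injective)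

  rank-< : (p q : Elem a d) → T (lt p q) → rank p < rank q
  rank-< (w i) (w j) p<q with toWitnessᴿ (lt-reflects (w i) (w j)) p<q
  ... | i≤j , wi≢wj = toℕ-< i≤j (wi≢wj ∘ cong w)
  rank-< (z i) (z j) p<q with toWitnessᴿ (lt-reflects (z i) (z j)) p<q
  ... | i≤j , zi≢zj = s≤s (ℕ.+-monoʳ-< a (toℕ-< i≤j (zi≢zj ∘ cong z)))
  rank-< (w i) x     _ = Finₚ.toℕ<n i
  rank-< (w i) y     _ = Finₚ.toℕ<n i
  rank-< (w i) (z j) _ = ℕ.≤-trans (Finₚ.toℕ<n i) (ℕ.≤-trans (ℕ.m≤m+n a (toℕ j)) (ℕ.n≤1+n _))
  rank-< x     (z j) _ = s≤s (ℕ.m≤m+n a (toℕ j))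
  rank-< y     (z j) _ = s≤s (ℕ.m≤m+n a (toℕ j))

  height : Elem a d → ℕ
  height u = a + d ∸ rank u

  height-< : (p q : Elem a d) → T (lt p q) → height q < height p
  height-< p q p<q = ℕ.∸-monoʳ-< (rank-< p q p<q) (rank-≤ q)

-- Subsets, down-sets and extremal elements

module _ {a d : ℕ} where

  infix 4 _∈ˢ_ _⊆_ _⊂_

  _∈ˢ_ : Elem a d → Sub a d → Set
  p ∈ˢ S = T (S p)

  _⊆_ : Sub a d → Sub a d → Set
  S ⊆ S′ = ∀ u → u ∈ˢ S → u ∈ˢ S′

  _⊂_ : Sub a d → Sub a d → Set
  S ⊂ S′ = S ⊆ S′ × ¬ S′ ⊆ S

  IsDownSet : Sub a d → Set
  IsDownSet S = ∀ q p → q ∈ˢ S × T (leq p q) → p ∈ˢ S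

  IsMaximal : Elem a d → Sub a d → Set
  IsMaximal p S = p ∈ˢ S × (∀ q → T (lt p q) → ¬ q ∈ˢ S)

  IsMinimal : Elem a d → Sub a d → Set
  IsMinimal p S = ¬ p ∈ˢ S × (∀ q → T (lt q p) → q ∈ˢ S)

  -- Tminus p I and Tplus p I are, definitionally, 𝟙 (isMaximalᵇ p S) and 𝟙 (isMinimalᵇ p S)
  -- for I = (S , _).
  isMaximalᵇ : Elem a d → Sub a d → Bool
  isMaximalᵇ p S = S p ∧ all (λ q → not (lt p q) ∨ not (S q)) (elems a d)

  isMinimalᵇ : Elem a d → Sub a d → Bool
  isMinimalᵇ p S = not (S p) ∧ all (λ q → not (lt q p) ∨ S q) (elems a d)

  _≗ᵇ_ : Sub a d → Sub a d → Bool
  S ≗ᵇ S′ = all (λ u → does (S u 𝔹.≟ S′ u)) (elems a d)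

  ⊆ᵇ-reflects : (S S′ : Sub a d) → Reflects (S ⊆ S′) (⊆ᵇ S S′)
  ⊆ᵇ-reflects S S′ = all-elems-reflects λ u → T-reflects (S u) →-reflects T-reflects (S′ u)

  ⊂ᵇ-reflects : (S S′ : Sub a d) → Reflects (S ⊂ S′) (⊂ᵇ S S′)
  ⊂ᵇ-reflects S S′ = ⊆ᵇ-reflects S S′ ×-reflects ¬-reflects (⊆ᵇ-reflects S′ S)

  isIdeal-reflects : (S : Sub a d) → Reflects (IsDownSet S) (isIdeal S)
  isIdeal-reflects S = all-elems-reflects λ q → all-elems-reflects λ p →
    (T-reflects (S q) ×-reflects T-reflects (leq p q)) →-reflects T-reflects (S p)

  isMaximal-reflects : (p : Elem a d) (S : Sub a d) → Reflects (IsMaximal p S) (isMaximalᵇ p S)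
  isMaximal-reflects p S = T-reflects (S p) ×-reflects
    all-elems-reflects λ q → T-reflects (lt p q) →-reflects ¬-reflects (T-reflects (S q))

  isMinimal-reflects : (p : Elem a d) (S : Sub a d) → Reflects (IsMinimal p S) (isMinimalᵇ p S)
  isMinimal-reflects p S = ¬-reflects (T-reflects (S p)) ×-reflects
    all-elems-reflects λ q → T-reflects (lt q p) →-reflects T-reflects (S q)

  ≗ᵇ-reflects : (S S′ : Sub a d) → Reflects (S ≗ S′) (S ≗ᵇ S′)
  ≗ᵇ-reflects S S′ = all-elems-reflects λ u → Dec.proof (S u 𝔹.≟ S′ u)

  downSet : (I : J a d) → IsDownSet (proj₁ I)
  downSet (S , isIdealS) = toWitnessᴿ (isIdeal-reflects S) (subst T (sym isIdealS) tt)

  ≗⇒⊆ : {S S′ : Sub a d} → S ≗ S′ → S ⊆ S′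
  ≗⇒⊆ S≗S′ u = subst T (S≗S′ u)

  ⊆-trans : {S S′ S″ : Sub a d} → S ⊆ S′ → S′ ⊆ S″ → S ⊆ S″
  ⊆-trans S⊆S′ S′⊆S″ u = S′⊆S″ u ∘ S⊆S′ u

  downSet-resp-≗ : {S X : Sub a d} → S ≗ X → IsDownSet X → IsDownSet S
  downSet-resp-≗ S≗X X↓ q p (q∈S , p≤q) =
    subst T (sym (S≗X p)) (X↓ q p (subst T (S≗X q) q∈S , p≤q))

  maximal-resp-≗ : {p : Elem a d} {S S′ : Sub a d} → S ≗ S′ → IsMaximal p S′ → IsMaximal p S
  maximal-resp-≗ S≗S′ (p∈S′ , p-top) =
    subst T (sym (S≗S′ _)) p∈S′ , λ q p<q q∈S → p-top q p<q (subst T (S≗S′ q) q∈S)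

  minimal-resp-≗ : {p : Elem a d} {S S′ : Sub a d} → S ≗ S′ → IsMinimal p S′ → IsMinimal p S
  minimal-resp-≗ S≗S′ (p∉S′ , p-bottom) =
    (λ p∈S → p∉S′ (subst T (S≗S′ _) p∈S)) , λ q q<p → subst T (sym (S≗S′ q)) (p-bottom q q<p)

  complement-upward : {S : Sub a d} → IsDownSet S → ∀ u v → T (lt u v) → ¬ u ∈ˢ S → ¬ v ∈ˢ S
  complement-upward S↓ u v u<v u∉S v∈S =
    u∉S (S↓ v u (v∈S , proj₁ (toWitnessᴿ (lt-reflects u v) u<v)))

  maximal-above : (S : Sub a d) {Q : Elem a d → Set} → (∀ p q → T (lt p q) → Q p → Q q) →
                  ∀ {q} → q ∈ˢ S → Q q → ∃[ p ] IsMaximal p S × Q p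
  maximal-above S {Q} Q-up {q} = climb q (<-wellFounded (height q))
    where
    climb : ∀ q → Acc _<_ (height q) → q ∈ˢ S → Q q → ∃[ p ] IsMaximal p S × Q p
    climb q (acc rs) q∈S Qq with isMaximalᵇ q S | isMaximal-reflects q S
    ... | true  | ofʸ q-max  = q , q-max , Qq
    ... | false | ofⁿ ¬q-max
      with r , ¬[q<r⇒r∉S] ← ¬∀⇒∃¬ (λ r → T-reflects (lt q r) →-reflects ¬-reflects (T-reflects (S r)))
                                   (λ q-top → ¬q-max (q∈S , q-top))
      with q<r , ¬r∉S ← reflects-¬→ (T-reflects (lt q r)) ¬[q<r⇒r∉S]
      = climb r (rs (height-< q r q<r)) (reflects-stable (T-reflects (S r)) ¬r∉S) (Q-up q r q<r Qq)

  maximal-outside : {S′ S : Sub a d} → IsDownSet S′ → ¬ S ⊆ S′ →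
                    ∃[ p ] IsMaximal p S × ¬ p ∈ˢ S′
  maximal-outside {S′} {S} S′↓ S⊈S′
    with q , ¬[q∈S⇒q∈S′] ← ¬∀⇒∃¬ (λ u → T-reflects (S u) →-reflects T-reflects (S′ u)) S⊈S′
    with q∈S , q∉S′ ← reflects-¬→ (T-reflects (S q)) ¬[q∈S⇒q∈S′]
    = maximal-above S (complement-upward S′↓) q∈S q∉S′

-- Covers and toggles

module _ {a d : ℕ} where

  remove : Elem a d → Sub a d → Sub a d
  remove p S u = S u ∧ not (u ==E p)

  -- insert e S is, definitionally, the subset that allSubs (e ∷ es) lists next to S.
  insert : Elem a d → Sub a d → Sub a d
  insert p S u = (u ==E p) ∨ S u

  remove-reflects : (p u : Elem a d) (S : Sub a d) → Reflects (u ∈ˢ S × u ≢ p) (remove p S u)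
  remove-reflects p u S = T-reflects (S u) ×-reflects ¬-reflects (==E-reflects u p)

  insert-reflects : (p u : Elem a d) (S : Sub a d) → Reflects (u ≡ p ⊎ u ∈ˢ S) (insert p S u)
  insert-reflects p u S = ==E-reflects u p ⊎-reflects T-reflects (S u)

  -- Toggle pairs serve twice: they are the covering pairs of J(P), and they match the ideals
  -- with p minimal outside against those with p maximal inside.
  Toggle : Elem a d → Sub a d → Sub a d → Set
  Toggle p S′ S = IsMaximal p S × S′ ≗ remove p S

  infix 4 _⋖_

  _⋖_ : Sub a d → Sub a d → Set
  S′ ⋖ S = S′ ⊂ S × (∀ K → IsDownSet K → ¬ (S′ ⊂ K × K ⊂ S))

  module _ {p : Elem a d} {S : Sub a d} where

    private
      ∈remove⁺ : ∀ {u} → u ∈ˢ S → u ≢ p → u ∈ˢ remove p S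
      ∈remove⁺ {u} u∈S u≢p = fromWitnessᴿ (remove-reflects p u S) (u∈S , u≢p)

      ∈remove⁻ : ∀ {u} → u ∈ˢ remove p S → u ∈ˢ S × u ≢ p
      ∈remove⁻ {u} = toWitnessᴿ (remove-reflects p u S)

      ∈insert⁺ : ∀ {u} → u ≡ p ⊎ u ∈ˢ S → u ∈ˢ insert p S
      ∈insert⁺ {u} = fromWitnessᴿ (insert-reflects p u S)

      ∈insert⁻ : ∀ {u} → u ∈ˢ insert p S → u ≡ p ⊎ u ∈ˢ S
      ∈insert⁻ {u} = toWitnessᴿ (insert-reflects p u S)

    remove-downSet : IsDownSet S → IsMaximal p S → IsDownSet (remove p S)
    remove-downSet S↓ (_ , p-top) q u (q∈S∖p , u≤q) with q∈S , q≢p ← ∈remove⁻ q∈S∖p =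
      ∈remove⁺ (S↓ q u (q∈S , u≤q))
               (λ { refl → p-top q (fromWitnessᴿ (lt-reflects p q) (u≤q , q≢p ∘ sym)) q∈S })

    insert-downSet : IsDownSet S → IsMinimal p S → IsDownSet (insert p S)
    insert-downSet S↓ (_ , p-bottom) q u (q∈S∪p , u≤q) with ∈insert⁻ q∈S∪p
    ... | inj₂ q∈S  = ∈insert⁺ (inj₂ (S↓ q u (q∈S , u≤q)))
    ... | inj₁ refl with u ≟E p
    ...   | yes u≡p = ∈insert⁺ (inj₁ u≡p)
    ...   | no  u≢p = ∈insert⁺ (inj₂ (p-bottom u (fromWitnessᴿ (lt-reflects u p) (u≤q , u≢p))))

    remove-minimal : IsDownSet S → IsMaximal p S → IsMinimal p (remove p S)
    remove-minimal S↓ (p∈S , _) = (λ p∈S∖p → proj₂ (∈remove⁻ p∈S∖p) refl) , below-p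
      where
      below-p : ∀ q → T (lt q p) → q ∈ˢ remove p S
      below-p q q<p with q≤p , q≢p ← toWitnessᴿ (lt-reflects q p) q<p =
        ∈remove⁺ (S↓ p q (p∈S , q≤p)) q≢p

    insert-maximal : IsDownSet S → ¬ p ∈ˢ S → IsMaximal p (insert p S)
    insert-maximal S↓ p∉S = ∈insert⁺ (inj₁ refl) , p-top
      where
      p-top : ∀ q → T (lt p q) → ¬ q ∈ˢ insert p S
      p-top q p<q q∈S∪p with toWitnessᴿ (lt-reflects p q) p<q | ∈insert⁻ q∈S∪p
      ... | _   , p≢q | inj₁ refl = p≢q refl
      ... | p≤q , _   | inj₂ q∈S  = p∉S (S↓ q p (q∈S , p≤q))

    remove⇒insert : {K : Sub a d} → p ∈ˢ K → S ≗ remove p K → K ≗ insert p S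
    remove⇒insert {K} p∈K S≗K∖p u = T-ext to from
      where
      to : u ∈ˢ K → u ∈ˢ insert p S
      to u∈K with u ≟E p
      ... | yes u≡p = ∈insert⁺ (inj₁ u≡p)
      ... | no  u≢p = ∈insert⁺ (inj₂ (subst T (sym (S≗K∖p u))
                                      (fromWitnessᴿ (remove-reflects p u K) (u∈K , u≢p))))
      from : u ∈ˢ insert p S → u ∈ˢ K
      from u∈S∪p with ∈insert⁻ u∈S∪p
      ... | inj₁ refl = p∈K
      ... | inj₂ u∈S  = proj₁ (toWitnessᴿ (remove-reflects p u K) (subst T (S≗K∖p u) u∈S))

    insert⇒remove : {K : Sub a d} → ¬ p ∈ˢ S → K ≗ insert p S → S ≗ remove p K
    insert⇒remove {K} p∉S K≗S∪p u = T-ext to from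
      where
      to : u ∈ˢ S → u ∈ˢ remove p K
      to u∈S = fromWitnessᴿ (remove-reflects p u K)
                 (subst T (sym (K≗S∪p u)) (∈insert⁺ (inj₂ u∈S)) , λ { refl → p∉S u∈S })
      from : u ∈ˢ remove p K → u ∈ˢ S
      from u∈K∖p with u∈K , u≢p ← toWitnessᴿ (remove-reflects p u K) u∈K∖p
                 with ∈insert⁻ (subst T (K≗S∪p u) u∈K)
      ... | inj₁ u≡p = ⊥-elim (u≢p u≡p)
      ... | inj₂ u∈S = u∈S

    toggle⇒⋖ : {S′ : Sub a d} → Toggle p S′ S → S′ ⋖ S
    toggle⇒⋖ {S′} ((p∈S , _) , S′≗S∖p) = (S′⊆S , S⊈S′) , no-between
      where
      S′⊆S : S′ ⊆ S
      S′⊆S u u∈S′ = proj₁ (∈remove⁻ (subst T (S′≗S∖p u) u∈S′))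
      S⊈S′ : ¬ S ⊆ S′
      S⊈S′ S⊆S′ = proj₂ (∈remove⁻ (subst T (S′≗S∖p p) (S⊆S′ p p∈S))) refl
      ∈S′ : ∀ {u} → u ∈ˢ S → u ≢ p → u ∈ˢ S′
      ∈S′ {u} u∈S u≢p = subst T (sym (S′≗S∖p u)) (∈remove⁺ u∈S u≢p)
      no-between : ∀ K → IsDownSet K → ¬ (S′ ⊂ K × K ⊂ S)
      no-between K _ ((S′⊆K , K⊈S′) , (K⊆S , S⊈K)) with T? (K p)
      ... | yes p∈K = S⊈K λ u u∈S → case u ≟E p of λ where
                        (yes refl) → p∈K
                        (no u≢p)   → S′⊆K u (∈S′ u∈S u≢p)
      ... | no  p∉K = K⊈S′ λ u u∈K → ∈S′ (K⊆S u u∈K) λ { refl → p∉K u∈K }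

  ⋖⇒toggle : {S′ S : Sub a d} → IsDownSet S′ → IsDownSet S → S′ ⋖ S → ∃[ p ] Toggle p S′ S
  ⋖⇒toggle {S′} {S} S′↓ S↓ ((S′⊆S , S⊈S′) , no-between) = toggle (maximal-outside S′↓ S⊈S′)
    where
    toggle : ∃[ p ] IsMaximal p S × ¬ p ∈ˢ S′ → ∃[ p ] Toggle p S′ S
    toggle (p , p-max , p∉S′) = p , p-max , λ u → T-ext (S′⊆S∖p u) (S∖p⊆S′ u)
      where
      S′⊆S∖p : S′ ⊆ remove p S
      S′⊆S∖p u u∈S′ =
        fromWitnessᴿ (remove-reflects p u S) (S′⊆S u u∈S′ , λ { refl → p∉S′ u∈S′ })
      S∖p⊂S : remove p S ⊂ S
      S∖p⊂S = (λ u → proj₁ ∘ toWitnessᴿ (remove-reflects p u S)) ,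
              (λ S⊆S∖p → proj₂ (toWitnessᴿ (remove-reflects p p S) (S⊆S∖p p (proj₁ p-max))) refl)
      S∖p⊆S′ : remove p S ⊆ S′
      S∖p⊆S′ = reflects-stable (⊆ᵇ-reflects (remove p S) S′) λ S∖p⊈S′ →
        no-between (remove p S) (remove-downSet S↓ p-max) ((S′⊆S∖p , S∖p⊈S′) , S∖p⊂S)

  toggle-unique : {p q : Elem a d} {S′ S : Sub a d} → Toggle p S′ S → Toggle q S′ S → p ≡ q
  toggle-unique {p} {q} {S′} {S} ((p∈S , _) , S′≗S∖p) (_ , S′≗S∖q) with p ≟E q
  ... | yes p≡q = p≡q
  ... | no  p≢q = ⊥-elim (proj₂ (toWitnessᴿ (remove-reflects p p S) p∈S∖p) refl)
    where
    p∈S∖p : p ∈ˢ remove p S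
    p∈S∖p = subst T (trans (sym (S′≗S∖q p)) (S′≗S∖p p))
                    (fromWitnessᴿ (remove-reflects q p S) (p∈S , p≢q))

-- Counting ideals

module _ {a d : ℕ} where

  Supported : List (Elem a d) → Sub a d → Set
  Supported es S = ∀ u → u ∈ˢ S → u ∈ es

  allSubs-supported : (es : List (Elem a d)) → All (Supported es) (allSubs es)
  allSubs-supported []       = (λ _ ()) ∷ []
  allSubs-supported (e ∷ es) = pairs (allSubs es) (allSubs-supported es)
    where
    pairs : (Ss : List (Sub a d)) → All (Supported es) Ss →
            All (Supported (e ∷ es)) (concatMap (λ S → S ∷ insert e S ∷ []) Ss)
    pairs []       []             = []
    pairs (S ∷ Ss) (S⊆es ∷ Ss⊆es) =
      (λ u → there ∘ S⊆es u) ∷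
      (λ u u∈S∪e → [ (λ { refl → here refl }) , there ∘ S⊆es u ]
                     (toWitnessᴿ (insert-reflects e u S) u∈S∪e)) ∷
      pairs Ss Ss⊆es

  ≗ᵇ-≡ : (S X S′ X′ : Sub a d) → (S ≗ X → S′ ≗ X′) → (S′ ≗ X′ → S ≗ X) →
         S ≗ᵇ X ≡ S′ ≗ᵇ X′
  ≗ᵇ-≡ S X S′ X′ f g = reflects-≡ f g (≗ᵇ-reflects S X) (≗ᵇ-reflects S′ X′)

  𝟙-≗ᵇ-differ : (S X : Sub a d) (u : Elem a d) → S u ≢ X u → 𝟙 (S ≗ᵇ X) ≡ 0
  𝟙-≗ᵇ-differ S X u Su≢Xu = 𝟙-¬T (λ S≗X → Su≢Xu (toWitnessᴿ (≗ᵇ-reflects S X) S≗X u))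

  ∑-allSubs-≗ᵇ : (es : List (Elem a d)) → Unique es → (X : Sub a d) → Supported es X →
                 ∑ (allSubs es) (λ S → 𝟙 (S ≗ᵇ X)) ≡ 1
  ∑-allSubs-≗ᵇ [] _ X X⊆[] =
    trans (ℕ.+-identityʳ _) (𝟙-T (fromWitnessᴿ (≗ᵇ-reflects (λ _ → false) X) ∅≗X))
    where
    ∅≗X : (λ _ → false) ≗ X
    ∅≗X u = sym (T-ext (λ u∈X → case X⊆[] u u∈X of λ ()) λ ())
  ∑-allSubs-≗ᵇ (e ∷ es) e∷es-unique@(_ AllPairs.∷ es-unique) X X⊆e∷es = begin
      ∑ (allSubs (e ∷ es)) (λ S → 𝟙 (S ≗ᵇ X))
    ≡⟨ ∑-pairs (insert e) (allSubs es) (λ S → 𝟙 (S ≗ᵇ X)) ⟩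
      ∑ (allSubs es) (λ S → 𝟙 (S ≗ᵇ X) + 𝟙 (insert e S ≗ᵇ X))
    ≡⟨ ∑-cong-All (allSubs-supported es) (λ S S⊆es → split S (e∉es ∘ S⊆es e)) ⟩
      ∑ (allSubs es) (λ S → 𝟙 (S ≗ᵇ remove e X))
    ≡⟨ ∑-allSubs-≗ᵇ es es-unique (remove e X) X∖e⊆es ⟩
      1 ∎
    where
    open ≡-Reasoning
    e∉es : e ∉ es
    e∉es = Uniqueₚ.Unique[x∷xs]⇒x∉xs e∷es-unique
    X∖e⊆es : Supported es (remove e X)
    X∖e⊆es u u∈X∖e with u∈X , u≢e ← toWitnessᴿ (remove-reflects e u X) u∈X∖e
                   with X⊆e∷es u u∈X
    ... | here u≡e   = ⊥-elim (u≢e u≡e)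
    ... | there u∈es = u∈es
    split : (S : Sub a d) → ¬ e ∈ˢ S → 𝟙 (S ≗ᵇ X) + 𝟙 (insert e S ≗ᵇ X) ≡ 𝟙 (S ≗ᵇ remove e X)
    split S e∉S with T? (X e)
    ... | yes e∈X = cong₂ _+_
      (𝟙-≗ᵇ-differ S X e λ Se≡Xe → e∉S (subst T (sym Se≡Xe) e∈X))
      (cong 𝟙 (≗ᵇ-≡ (insert e S) X S (remove e X) (λ S∪e≗X → insert⇒remove e∉S (sym ∘ S∪e≗X))
                                                  (λ S≗X∖e → sym ∘ remove⇒insert e∈X S≗X∖e)))
    ... | no  e∉X = trans (cong₂ _+_
      (cong 𝟙 (≗ᵇ-≡ S X S (remove e X) (λ S≗X u → trans (S≗X u) (X≗X∖e u))
                                       (λ S≗X∖e u → trans (S≗X∖e u) (sym (X≗X∖e u)))))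
      (𝟙-≗ᵇ-differ (insert e S) X e λ S∪e≡Xe →
        e∉X (subst T S∪e≡Xe (fromWitnessᴿ (insert-reflects e e S) (inj₁ refl)))))
      (ℕ.+-identityʳ _)
      where
      X≗X∖e : X ≗ remove e X
      X≗X∖e u = T-ext (λ u∈X → fromWitnessᴿ (remove-reflects e u X) (u∈X , λ { refl → e∉X u∈X }))
                      (proj₁ ∘ toWitnessᴿ (remove-reflects e u X))

  ∑-collect : (Ss : List (Sub a d)) (f : Sub a d → ℕ) →
              ∑ (collect Ss) (f ∘ proj₁) ≡ ∑ Ss (λ S → 𝟙 (isIdeal S) * f S)
  ∑-collect []       f = refl
  ∑-collect (S ∷ Ss) f =
    trans (∑-keep (isIdeal S) refl (collect Ss)) (cong (_+_ (𝟙 (isIdeal S) * f S)) (∑-collect Ss f))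
    where
    ∑-keep : (b : Bool) (e : isIdeal S ≡ b) (r : List (J a d)) →
             ∑ (keep S b e r) (f ∘ proj₁) ≡ 𝟙 b * f S + ∑ r (f ∘ proj₁)
    ∑-keep true  _ r = cong (_+ ∑ r (f ∘ proj₁)) (sym (ℕ.*-identityˡ (f S)))
    ∑-keep false _ r = refl

  ∑-ideals-≗ᵇ : {X : Sub a d} → IsDownSet X → ∑ (ideals a d) (λ K → 𝟙 (proj₁ K ≗ᵇ X)) ≡ 1
  ∑-ideals-≗ᵇ {X} X↓ =
    trans (∑-collect (allSubs (elems a d)) (λ S → 𝟙 (S ≗ᵇ X)))
    (trans (∑-cong (allSubs (elems a d)) only-ideals)
           (∑-allSubs-≗ᵇ (elems a d) elems-unique X (λ u _ → ∈-elems u)))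
    where
    only-ideals : ∀ S → 𝟙 (isIdeal S) * 𝟙 (S ≗ᵇ X) ≡ 𝟙 (S ≗ᵇ X)
    only-ideals S with S ≗ᵇ X | ≗ᵇ-reflects S X
    ... | true  | ofʸ S≗X =
      cong (_* 1) (𝟙-T (fromWitnessᴿ (isIdeal-reflects S) (downSet-resp-≗ S≗X X↓)))
    ... | false | _       = ℕ.*-zeroʳ (𝟙 (isIdeal S))

  ideals-complete : {X : Sub a d} → IsDownSet X → Any (λ K → proj₁ K ≗ X) (ideals a d)
  ideals-complete {X} X↓ = Any.map (toWitnessᴿ (≗ᵇ-reflects _ X))
    (∑-𝟙⇒Any (ideals a d) λ ∑≡0 → case trans (sym (∑-ideals-≗ᵇ X↓)) ∑≡0 of λ ())

  coveredBy-reflects : (I′ I : J a d) → Reflects (proj₁ I′ ⋖ proj₁ I) (coveredBy I′ I)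
  coveredBy-reflects (S′ , _) (S , _) = reflects-map to from
    (⊂ᵇ-reflects S′ S ×-reflects ¬-reflects
      (any-reflects (λ K → ⊂ᵇ-reflects S′ (proj₁ K) ×-reflects ⊂ᵇ-reflects (proj₁ K) S) (ideals a d)))
    where
    Between : J a d → Set
    Between K = S′ ⊂ proj₁ K × proj₁ K ⊂ S
    to : S′ ⊂ S × ¬ Any Between (ideals a d) → S′ ⋖ S
    to (S′⊂S , none) = S′⊂S , λ K K↓ ((S′⊆K , K⊈S′) , (K⊆S , S⊈K)) →
      none (Any.map (λ K′≗K → let K⊆K′ = ≗⇒⊆ (sym ∘ K′≗K) ; K′⊆K = ≗⇒⊆ K′≗K in
                              (⊆-trans S′⊆K K⊆K′ , λ K′⊆S′ → K⊈S′ (⊆-trans K⊆K′ K′⊆S′)) ,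
                              (⊆-trans K′⊆K K⊆S  , λ S⊆K′ → S⊈K (⊆-trans S⊆K′ K′⊆K)))
                    (ideals-complete K↓))
    from : S′ ⋖ S → S′ ⊂ S × ¬ Any Between (ideals a d)
    from (S′⊂S , no-between) = S′⊂S , λ between →
      let K , S′⊂K⊂S = Any.satisfied between in no-between (proj₁ K) (downSet K) S′⊂K⊂S

  toggleᵇ : Elem a d → Sub a d → Sub a d → Bool
  toggleᵇ p S′ S = isMaximalᵇ p S ∧ (S′ ≗ᵇ remove p S)

  toggle-reflects : (p : Elem a d) (S′ S : Sub a d) → Reflects (Toggle p S′ S) (toggleᵇ p S′ S)
  toggle-reflects p S′ S = isMaximal-reflects p S ×-reflects ≗ᵇ-reflects S′ (remove p S)

  𝟙-coveredBy : (I′ I : J a d) →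
                𝟙 (coveredBy I′ I) ≡ ∑ (elems a d) (λ p → 𝟙 (toggleᵇ p (proj₁ I′) (proj₁ I)))
  𝟙-coveredBy I′ I with coveredBy I′ I | coveredBy-reflects I′ I
  ... | true  | ofʸ I′⋖I with p₀ , toggle₀ ← ⋖⇒toggle (downSet I′) (downSet I) I′⋖I =
    sym (trans (∑-cong (elems a d) λ p →
                  cong 𝟙 (reflects-≡ (λ t → toggle-unique t toggle₀) (λ { refl → toggle₀ })
                                     (toggle-reflects p _ _) (==E-reflects p p₀)))
               (∑-elems-==E p₀))
  ... | false | ofⁿ ¬I′⋖I =
    sym (∑-𝟙-false (elems a d) λ p t → ¬I′⋖I (toggle⇒⋖ (toWitnessᴿ (toggle-reflects p _ _) t)))

  ∑-toggle-below : (p : Elem a d) (I : J a d) →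
                   ∑ (ideals a d) (λ I′ → 𝟙 (toggleᵇ p (proj₁ I′) (proj₁ I))) ≡ Tminus p I
  ∑-toggle-below p I@(S , _) with isMaximalᵇ p S | isMaximal-reflects p S
  ... | true  | ofʸ p-max = ∑-ideals-≗ᵇ (remove-downSet (downSet I) p-max)
  ... | false | _         = ∑-zero (ideals a d) (λ _ → refl)

  ∑-toggle-above : (p : Elem a d) (I : J a d) →
                   ∑ (ideals a d) (λ K → 𝟙 (toggleᵇ p (proj₁ I) (proj₁ K))) ≡ Tplus p I
  ∑-toggle-above p I@(S , _) with isMinimalᵇ p S | isMinimal-reflects p S
  ... | true  | ofʸ (p∉S , p-bottom) =
    trans (∑-cong (ideals a d) λ K → cong 𝟙 (reflects-≡
            (λ ((p∈K , _) , S≗K∖p) → remove⇒insert p∈K S≗K∖p)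
            (λ K≗S∪p → maximal-resp-≗ K≗S∪p (insert-maximal (downSet I) p∉S) ,
                       insert⇒remove p∉S K≗S∪p)
            (toggle-reflects p S (proj₁ K)) (≗ᵇ-reflects (proj₁ K) (insert p S))))
          (∑-ideals-≗ᵇ (insert-downSet (downSet I) (p∉S , p-bottom)))
  ... | false | ofⁿ ¬p-min = ∑-𝟙-false (ideals a d) λ K t →
    let p-max , S≗K∖p = toWitnessᴿ (toggle-reflects p S (proj₁ K)) t
    in ¬p-min (minimal-resp-≗ S≗K∖p (remove-minimal (downSet K) p-max))

  ddeg≡∑Tminus : (I : J a d) → ddeg I ≡ ∑ (elems a d) (λ p → Tminus p I)
  ddeg≡∑Tminus I = begin
      ddeg I
    ≡⟨ length-filter (ideals a d) (λ I′ → coveredBy I′ I) ⟩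
      ∑ (ideals a d) (λ I′ → 𝟙 (coveredBy I′ I))
    ≡⟨ ∑-cong (ideals a d) (λ I′ → 𝟙-coveredBy I′ I) ⟩
      ∑ (ideals a d) (λ I′ → ∑ (elems a d) (λ p → 𝟙 (toggleᵇ p (proj₁ I′) (proj₁ I))))
    ≡⟨ ∑-swap (ideals a d) (elems a d) (λ I′ p → 𝟙 (toggleᵇ p (proj₁ I′) (proj₁ I))) ⟩
      ∑ (elems a d) (λ p → ∑ (ideals a d) (λ I′ → 𝟙 (toggleᵇ p (proj₁ I′) (proj₁ I))))
    ≡⟨ ∑-cong (elems a d) (λ p → ∑-toggle-below p I) ⟩
      ∑ (elems a d) (λ p → Tminus p I) ∎
    where open ≡-Reasoning

  ∑Tplus≡∑Tminus : (p : Elem a d) → ∑ (ideals a d) (Tplus p) ≡ ∑ (ideals a d) (Tminus p)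
  ∑Tplus≡∑Tminus p = begin
      ∑ (ideals a d) (Tplus p)
    ≡⟨ ∑-cong (ideals a d) (sym ∘ ∑-toggle-above p) ⟩
      ∑ (ideals a d) (λ I → ∑ (ideals a d) (λ K → 𝟙 (toggleᵇ p (proj₁ I) (proj₁ K))))
    ≡⟨ ∑-swap (ideals a d) (ideals a d) (λ I K → 𝟙 (toggleᵇ p (proj₁ I) (proj₁ K))) ⟩
      ∑ (ideals a d) (λ K → ∑ (ideals a d) (λ I → 𝟙 (toggleᵇ p (proj₁ I) (proj₁ K))))
    ≡⟨ ∑-cong (ideals a d) (∑-toggle-below p) ⟩
      ∑ (ideals a d) (Tminus p) ∎
    where open ≡-Reasoning

-- The toggle identity for the down-degree

-- lt (w i) (w j) and lt (z i) (z j) both reduce to i <ᶠ j.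
_<ᶠ_ : {n : ℕ} → Fin n → Fin n → Bool
i <ᶠ j = (toℕ i ≤ᵇ toℕ j) ∧ not ⌊ i Finₚ.≟ j ⌋

private
  allFin-suc : (n : ℕ) → allFin (suc n) ≡ Fin.zero ∷ map Fin.suc (allFin n)
  allFin-suc n = cong (Fin.zero ∷_) (sym (Listₚ.map-tabulate id Fin.suc))

  suc-<ᶠ-suc : {n : ℕ} (i j : Fin n) → Fin.suc i <ᶠ Fin.suc j ≡ i <ᶠ j
  suc-<ᶠ-suc i j = cong₂ (λ b c → b ∧ not c) (≤ᵇ-suc (toℕ i) (toℕ j)) (⌊⌋-map′ _ _ (i Finₚ.≟ j))
    where
    ≤ᵇ-suc : (m n : ℕ) → (suc m ≤ᵇ suc n) ≡ (m ≤ᵇ n)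
    ≤ᵇ-suc zero    n = refl
    ≤ᵇ-suc (suc m) n = refl

  ∑-allFin-suc : (n : ℕ) (f : Fin (suc n) → ℕ) →
                 ∑ (allFin (suc n)) f ≡ f Fin.zero + ∑ (allFin n) (f ∘ Fin.suc)
  ∑-allFin-suc n f =
    trans (cong (λ l → ∑ l f) (allFin-suc n)) (cong (_+_ (f Fin.zero)) (∑-map Fin.suc (allFin n) f))

  all-allFin-suc : (n : ℕ) (f : Fin (suc n) → Bool) →
                   all f (allFin (suc n)) ≡ f Fin.zero ∧ all (f ∘ Fin.suc) (allFin n)
  all-allFin-suc n f =
    trans (cong (all f) (allFin-suc n)) (cong (f Fin.zero ∧_) (cong and (sym (Listₚ.map-∘ (allFin n)))))

  all-≗ : {A : Set} (l : List A) {f g : A → Bool} → f ≗ g → all f l ≡ all g l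
  all-≗ l f≗g = cong and (Listₚ.map-cong f≗g l)

  all-true : {A : Set} (l : List A) → all (λ _ → true) l ≡ true
  all-true []      = refl
  all-true (_ ∷ l) = all-true l

∑-first-false : (n : ℕ) (b : Fin n → Bool) →
                ∑ (allFin n) (λ i → 𝟙 (not (b i) ∧ all (λ j → not (j <ᶠ i) ∨ b j) (allFin n)))
                ≡ 𝟙 (not (all b (allFin n)))
∑-first-false zero    b = refl
∑-first-false (suc n) b = begin
    ∑ (allFin (suc n)) first
  ≡⟨ ∑-allFin-suc n first ⟩
    first Fin.zero + ∑ (allFin n) (first ∘ Fin.suc)
  ≡⟨ cong₂ _+_ (cong (λ c → 𝟙 (not (b Fin.zero) ∧ c)) below-zero) below-suc ⟩
    𝟙 (not (b Fin.zero) ∧ true) + 𝟙 (b Fin.zero) * 𝟙 (not (all (b ∘ Fin.suc) (allFin n)))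
  ≡⟨ combine (b Fin.zero) (all (b ∘ Fin.suc) (allFin n)) ⟩
    𝟙 (not (b Fin.zero ∧ all (b ∘ Fin.suc) (allFin n)))
  ≡⟨ cong (𝟙 ∘ not) (sym (all-allFin-suc n b)) ⟩
    𝟙 (not (all b (allFin (suc n)))) ∎
  where
  open ≡-Reasoning
  first : Fin (suc n) → ℕ
  first i = 𝟙 (not (b i) ∧ all (λ j → not (j <ᶠ i) ∨ b j) (allFin (suc n)))
  below-zero : all (λ j → not (j <ᶠ Fin.zero) ∨ b j) (allFin (suc n)) ≡ true
  below-zero = trans (all-allFin-suc n (λ j → not (j <ᶠ Fin.zero) ∨ b j)) (all-true (allFin n))
  first-suc : ∀ i → first (Fin.suc i) ≡
    𝟙 (b Fin.zero) * 𝟙 (not (b (Fin.suc i)) ∧ all (λ j → not (j <ᶠ i) ∨ b (Fin.suc j)) (allFin n))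
  first-suc i rewrite all-allFin-suc n (λ j → not (j <ᶠ Fin.suc i) ∨ b j)
                    | all-≗ (allFin n) (λ j → cong (λ c → not c ∨ b (Fin.suc j)) (suc-<ᶠ-suc j i))
    with b Fin.zero
  ... | true  = sym (ℕ.+-identityʳ _)
  ... | false = cong 𝟙 (𝔹.∧-zeroʳ (not (b (Fin.suc i))))
  below-suc : ∑ (allFin n) (first ∘ Fin.suc) ≡ 𝟙 (b Fin.zero) * 𝟙 (not (all (b ∘ Fin.suc) (allFin n)))
  below-suc = trans (∑-cong (allFin n) first-suc)
              (trans (∑-distribˡ-* (allFin n) (𝟙 (b Fin.zero)) _)
                     (cong (𝟙 (b Fin.zero) *_) (∑-first-false n (b ∘ Fin.suc))))
  combine : (c r : Bool) → 𝟙 (not c ∧ true) + 𝟙 c * 𝟙 (not r) ≡ 𝟙 (not (c ∧ r))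
  combine false r = refl
  combine true  r = ℕ.+-identityʳ (𝟙 (not r))

∑-last-true : (n : ℕ) (b : Fin n → Bool) →
              ∑ (allFin n) (λ i → 𝟙 (b i ∧ all (λ k → not (i <ᶠ k) ∨ not (b k)) (allFin n)))
              ≡ 𝟙 (not (all (not ∘ b) (allFin n)))
∑-last-true zero    b = refl
∑-last-true (suc n) b = begin
    ∑ (allFin (suc n)) last
  ≡⟨ ∑-allFin-suc n last ⟩
    last Fin.zero + ∑ (allFin n) (last ∘ Fin.suc)
  ≡⟨ cong₂ _+_ (cong (λ c → 𝟙 (b Fin.zero ∧ c)) above-zero)
               (trans (∑-cong (allFin n) last-suc) (∑-last-true n (b ∘ Fin.suc))) ⟩
    𝟙 (b Fin.zero ∧ none-above) + 𝟙 (not none-above)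
  ≡⟨ combine (b Fin.zero) none-above ⟩
    𝟙 (not (not (b Fin.zero) ∧ none-above))
  ≡⟨ cong (𝟙 ∘ not) (sym (all-allFin-suc n (not ∘ b))) ⟩
    𝟙 (not (all (not ∘ b) (allFin (suc n)))) ∎
  where
  open ≡-Reasoning
  none-above : Bool
  none-above = all (not ∘ b ∘ Fin.suc) (allFin n)
  last : Fin (suc n) → ℕ
  last i = 𝟙 (b i ∧ all (λ k → not (i <ᶠ k) ∨ not (b k)) (allFin (suc n)))
  above-zero : all (λ k → not (Fin.zero <ᶠ k) ∨ not (b k)) (allFin (suc n)) ≡ none-above
  above-zero = all-allFin-suc n (λ k → not (Fin.zero <ᶠ k) ∨ not (b k))
  last-suc : ∀ i → last (Fin.suc i) ≡
    𝟙 (b (Fin.suc i) ∧ all (λ k → not (i <ᶠ k) ∨ not (b (Fin.suc k))) (allFin n))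
  last-suc i = cong (λ c → 𝟙 (b (Fin.suc i) ∧ c))
    (trans (all-allFin-suc n (λ k → not (Fin.suc i <ᶠ k) ∨ not (b k)))
           (all-≗ (allFin n) (λ k → cong (λ c → not c ∨ not (b (Fin.suc k))) (suc-<ᶠ-suc i k))))
  combine : (c r : Bool) → 𝟙 (c ∧ r) + 𝟙 (not r) ≡ 𝟙 (not (not c ∧ r))
  combine false r     = refl
  combine true  false = refl
  combine true  true  = refl

module _ {a d : ℕ} where

  -- ddeg − 1 = Σ_p (c⁺ p / 2) (T⁻_p − T⁺_p); c⁻ = 2 − c⁺ takes up the rest of
  -- 2 ddeg = 2 Σ_p T⁻_p.
  c⁺ : Elem a d → ℕ
  c⁺ (w _) = 2
  c⁺ x     = 1
  c⁺ y     = 1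
  c⁺ (z _) = 0

  c⁻ : Elem a d → ℕ
  c⁻ (w _) = 0
  c⁻ x     = 1
  c⁻ y     = 1
  c⁻ (z _) = 2

  c⁺+c⁻≡2 : (p : Elem a d) → c⁺ p + c⁻ p ≡ 2
  c⁺+c⁻≡2 (w _) = refl
  c⁺+c⁻≡2 x     = refl
  c⁺+c⁻≡2 y     = refl
  c⁺+c⁻≡2 (z _) = refl

  -- allW: every w_i lies in I; noZ: no z_j does; sx, sy: x_1 ∈ I, y_1 ∈ I.
  balance-cases : (allW sx sy noZ : Bool) →
                  (T sx → T allW) → (T sy → T allW) → (T (not noZ) → T sx) → (T (not noZ) → T sy) →
                  2 * 𝟙 (not allW) + ((𝟙 (not sx ∧ allW) + 𝟙 (sx ∧ noZ)) +
                                      ((𝟙 (not sy ∧ allW) + 𝟙 (sy ∧ noZ)) + 2 * 𝟙 (not noZ))) ≡ 2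
  balance-cases true  false false true  _   _   _   _   = refl
  balance-cases true  false true  true  _   _   _   _   = refl
  balance-cases true  true  false true  _   _   _   _   = refl
  balance-cases true  true  true  true  _   _   _   _   = refl
  balance-cases true  true  true  false _   _   _   _   = refl
  balance-cases false false false true  _   _   _   _   = refl
  balance-cases _     false _     false _   _   z⇒x _   = ⊥-elim (z⇒x tt)
  balance-cases _     _     false false _   _   _   z⇒y = ⊥-elim (z⇒y tt)
  balance-cases false true  _     _     x⇒w _   _   _   = ⊥-elim (x⇒w tt)
  balance-cases false _     true  _     _   y⇒w _   _   = ⊥-elim (y⇒w tt)

  module _ (I : J a d) where

    private
      S : Sub a d
      S = proj₁ I

    allW : Bool
    allW = all (λ i → S (w i)) (allFin a)

    noZ : Bool
    noZ = all (λ j → not (S (z j))) (allFin d)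

    Tplus-w : ∀ i → Tplus (w i) I ≡ 𝟙 (not (S (w i)) ∧ all (λ j → not (j <ᶠ i) ∨ S (w j)) (allFin a))
    Tplus-w i = cong (λ c → 𝟙 (not (S (w i)) ∧ c)) (reflects-≡ (λ h j → h (w j)) from
      (all-elems-reflects λ q → T-reflects (lt q (w i)) →-reflects T-reflects (S q))
      (all-allFin-reflects λ j → T-reflects (j <ᶠ i) →-reflects T-reflects (S (w j))))
      where
      from : (∀ j → T (j <ᶠ i) → T (S (w j))) → ∀ q → T (lt q (w i)) → T (S q)
      from h (w j) = h j

    Tplus-x : Tplus x I ≡ 𝟙 (not (S x) ∧ allW)
    Tplus-x = cong (λ c → 𝟙 (not (S x) ∧ c)) (reflects-≡ (λ h i → h (w i) tt) from
      (all-elems-reflects λ q → T-reflects (lt q x) →-reflects T-reflects (S q))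
      (all-allFin-reflects λ i → T-reflects (S (w i))))
      where
      from : (∀ i → T (S (w i))) → ∀ q → T (lt q x) → T (S q)
      from h (w i) _ = h i

    Tplus-y : Tplus y I ≡ 𝟙 (not (S y) ∧ allW)
    Tplus-y = cong (λ c → 𝟙 (not (S y) ∧ c)) (reflects-≡ (λ h i → h (w i) tt) from
      (all-elems-reflects λ q → T-reflects (lt q y) →-reflects T-reflects (S q))
      (all-allFin-reflects λ i → T-reflects (S (w i))))
      where
      from : (∀ i → T (S (w i))) → ∀ q → T (lt q y) → T (S q)
      from h (w i) _ = h i

    Tminus-x : Tminus x I ≡ 𝟙 (S x ∧ noZ)
    Tminus-x = cong (λ c → 𝟙 (S x ∧ c)) (reflects-≡ (λ h j → h (z j) tt) from
      (all-elems-reflects λ q → T-reflects (lt x q) →-reflects ¬-reflects (T-reflects (S q)))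
      (all-allFin-reflects λ j → ¬-reflects (T-reflects (S (z j)))))
      where
      from : (∀ j → ¬ T (S (z j))) → ∀ q → T (lt x q) → ¬ T (S q)
      from h (z j) _ = h j

    Tminus-y : Tminus y I ≡ 𝟙 (S y ∧ noZ)
    Tminus-y = cong (λ c → 𝟙 (S y ∧ c)) (reflects-≡ (λ h j → h (z j) tt) from
      (all-elems-reflects λ q → T-reflects (lt y q) →-reflects ¬-reflects (T-reflects (S q)))
      (all-allFin-reflects λ j → ¬-reflects (T-reflects (S (z j)))))
      where
      from : (∀ j → ¬ T (S (z j))) → ∀ q → T (lt y q) → ¬ T (S q)
      from h (z j) _ = h j

    Tminus-z : ∀ j → Tminus (z j) I ≡ 𝟙 (S (z j) ∧ all (λ k → not (j <ᶠ k) ∨ not (S (z k))) (allFin d))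
    Tminus-z j = cong (λ c → 𝟙 (S (z j) ∧ c)) (reflects-≡ (λ h k → h (z k)) from
      (all-elems-reflects λ q → T-reflects (lt (z j) q) →-reflects ¬-reflects (T-reflects (S q)))
      (all-allFin-reflects λ k → T-reflects (j <ᶠ k) →-reflects ¬-reflects (T-reflects (S (z k)))))
      where
      from : (∀ k → T (j <ᶠ k) → ¬ T (S (z k))) → ∀ q → T (lt (z j) q) → ¬ T (S q)
      from h (z k) = h k

    above-w : ∀ m → (∀ i → T (leq (w i) m)) → T (S m) → T allW
    above-w m w≤m m∈S =
      fromWitnessᴿ (all-allFin-reflects λ i → T-reflects (S (w i)))
                   (λ i → downSet I m (w i) (m∈S , w≤m i))

    below-z : ∀ m → (∀ j → T (leq m (z j))) → T (not noZ) → T (S m)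
    below-z m m≤z some-z = reflects-stable (T-reflects (S m)) λ m∉S →
      toWitnessᴿ (¬-reflects (T-reflects noZ)) some-z
        (fromWitnessᴿ (all-allFin-reflects λ j → ¬-reflects (T-reflects (S (z j))))
                      (λ j zj∈S → m∉S (downSet I (z j) m (zj∈S , m≤z j))))

  toggle-balance : (I : J a d) → ∑ (elems a d) (λ p → c⁺ p * Tplus p I + c⁻ p * Tminus p I) ≡ 2
  toggle-balance I = begin
      ∑ (elems a d) g
    ≡⟨ ∑-elems g ⟩
      ∑ (allFin a) (g ∘ w) + (g x + (g y + ∑ (allFin d) (g ∘ z)))
    ≡⟨ cong₂ _+_ w-part (cong₂ _+_ (middle (Tplus-x I) (Tminus-x I))
                                   (cong₂ _+_ (middle (Tplus-y I) (Tminus-y I)) z-part)) ⟩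
      2 * 𝟙 (not (allW I)) + ((𝟙 (not (S x) ∧ allW I) + 𝟙 (S x ∧ noZ I)) +
                             ((𝟙 (not (S y) ∧ allW I) + 𝟙 (S y ∧ noZ I)) + 2 * 𝟙 (not (noZ I))))
    ≡⟨ balance-cases (allW I) (S x) (S y) (noZ I)
                     (above-w I x (λ _ → tt)) (above-w I y (λ _ → tt))
                     (below-z I x (λ _ → tt)) (below-z I y (λ _ → tt)) ⟩
      2 ∎
    where
    open ≡-Reasoning
    S = proj₁ I
    g : Elem a d → ℕ
    g p = c⁺ p * Tplus p I + c⁻ p * Tminus p I
    w-part : ∑ (allFin a) (g ∘ w) ≡ 2 * 𝟙 (not (allW I))
    w-part = trans (∑-cong (allFin a) (λ i → trans (ℕ.+-identityʳ _) (cong (2 *_) (Tplus-w I i))))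
             (trans (∑-distribˡ-* (allFin a) 2 _) (cong (2 *_) (∑-first-false a (S ∘ w))))
    z-part : ∑ (allFin d) (g ∘ z) ≡ 2 * 𝟙 (not (noZ I))
    z-part = trans (∑-cong (allFin d) (λ j → cong (2 *_) (Tminus-z I j)))
             (trans (∑-distribˡ-* (allFin d) 2 _) (cong (2 *_) (∑-last-true d (S ∘ z))))
    middle : ∀ {m t⁺ t⁻} → Tplus m I ≡ t⁺ → Tminus m I ≡ t⁻ →
             1 * Tplus m I + 1 * Tminus m I ≡ t⁺ + t⁻
    middle {m} refl refl = cong₂ _+_ (ℕ.*-identityˡ (Tplus m I)) (ℕ.*-identityˡ (Tminus m I))

  ddeg-toggle-identity : (I : J a d) →
    2 * ddeg I + ∑ (elems a d) (λ p → c⁺ p * Tplus p I) ≡ 2 + ∑ (elems a d) (λ p → c⁺ p * Tminus p I)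
  ddeg-toggle-identity I = begin
      2 * ddeg I + C⁺
    ≡⟨ cong (λ t → 2 * t + C⁺) (ddeg≡∑Tminus I) ⟩
      2 * ∑ (elems a d) (λ p → Tminus p I) + C⁺
    ≡⟨ cong (_+ C⁺) (sym (∑-distribˡ-* (elems a d) 2 (λ p → Tminus p I))) ⟩
      ∑ (elems a d) (λ p → 2 * Tminus p I) + C⁺
    ≡⟨ cong (_+ C⁺) (trans (∑-cong (elems a d) split-2)
                           (∑-distrib-+ (elems a d) (λ p → c⁺ p * Tminus p I) (λ p → c⁻ p * Tminus p I))) ⟩
      (C⁻ + D⁻) + C⁺
    ≡⟨ ℕ.+-assoc C⁻ D⁻ C⁺ ⟩
      C⁻ + (D⁻ + C⁺)
    ≡⟨ cong (_+_ C⁻) (trans (ℕ.+-comm D⁻ C⁺) balance) ⟩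
      C⁻ + 2
    ≡⟨ ℕ.+-comm C⁻ 2 ⟩
      2 + C⁻ ∎
    where
    open ≡-Reasoning
    C⁺ C⁻ D⁻ : ℕ
    C⁺ = ∑ (elems a d) (λ p → c⁺ p * Tplus p I)
    C⁻ = ∑ (elems a d) (λ p → c⁺ p * Tminus p I)
    D⁻ = ∑ (elems a d) (λ p → c⁻ p * Tminus p I)
    split-2 : ∀ p → 2 * Tminus p I ≡ c⁺ p * Tminus p I + c⁻ p * Tminus p I
    split-2 p = trans (cong (_* Tminus p I) (sym (c⁺+c⁻≡2 p)))
                      (ℕ.*-distribʳ-+ (Tminus p I) (c⁺ p) (c⁻ p))
    balance : C⁺ + D⁻ ≡ 2
    balance = trans (sym (∑-distrib-+ (elems a d) (λ p → c⁺ p * Tplus p I) (λ p → c⁻ p * Tminus p I)))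
                    (toggle-balance I)

-- Expectations

module ℚ∑ = BigSum (CommutativeRing.commutativeSemiring ℚ.+-*-commutativeRing)

ℕtoℚ≡mkℚ : ∀ n → ℕtoℚ n ≡ mkℚ (+ n) 0 (coprime-sym (1-coprimeTo n))
ℕtoℚ≡mkℚ n = ℚ.normalize-coprime (coprime-sym (1-coprimeTo n))

ℕtoℚ-+ : ∀ m n → ℕtoℚ (m + n) ≡ ℕtoℚ m ℚ.+ ℕtoℚ n
ℕtoℚ-+ m n =
  ℚ.toℚᵘ-injective (ℚᵘ.≃-trans ℕ-homo (ℚᵘ.≃-sym (ℚ.toℚᵘ-homo-+ (ℕtoℚ m) (ℕtoℚ n))))
  where
  ℕ-homo : ℚ.toℚᵘ (ℕtoℚ (m + n)) ℚᵘ.≃ ℚ.toℚᵘ (ℕtoℚ m) ℚᵘ.+ ℚ.toℚᵘ (ℕtoℚ n)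
  ℕ-homo rewrite ℕtoℚ≡mkℚ (m + n) | ℕtoℚ≡mkℚ m | ℕtoℚ≡mkℚ n = ℚᵘ.*≡* (begin
      + (m + n) ℤ.* + 1                       ≡⟨ ℤ.*-identityʳ (+ (m + n)) ⟩
      + m ℤ.+ + n                             ≡⟨ cong₂ ℤ._+_ (sym (ℤ.*-identityʳ (+ m)))
                                                             (sym (ℤ.*-identityʳ (+ n))) ⟩
      + m ℤ.* + 1 ℤ.+ + n ℤ.* + 1             ≡⟨ sym (ℤ.*-identityʳ _) ⟩
      (+ m ℤ.* + 1 ℤ.+ + n ℤ.* + 1) ℤ.* + 1  ∎)
    where open ≡-Reasoning

ℕtoℚ-* : ∀ m n → ℕtoℚ (m * n) ≡ ℕtoℚ m ℚ.* ℕtoℚ n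
ℕtoℚ-* zero    n = sym (ℚ.*-zeroˡ (ℕtoℚ n))
ℕtoℚ-* (suc m) n = begin
    ℕtoℚ (n + m * n)                      ≡⟨ ℕtoℚ-+ n (m * n) ⟩
    ℕtoℚ n ℚ.+ ℕtoℚ (m * n)               ≡⟨ cong₂ ℚ._+_ (sym (ℚ.*-identityˡ (ℕtoℚ n)))
                                                          (ℕtoℚ-* m n) ⟩
    1ℚ ℚ.* ℕtoℚ n ℚ.+ ℕtoℚ m ℚ.* ℕtoℚ n   ≡⟨ sym (ℚ.*-distribʳ-+ (ℕtoℚ n) 1ℚ (ℕtoℚ m)) ⟩
    (1ℚ ℚ.+ ℕtoℚ m) ℚ.* ℕtoℚ n           ≡⟨ cong (ℚ._* ℕtoℚ n) (sym (ℕtoℚ-+ 1 m)) ⟩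
    ℕtoℚ (suc m) ℚ.* ℕtoℚ n              ∎
  where open ≡-Reasoning

ℕtoℚ-*-inverse : (n : ℕ) .{{_ : NonZero n}} → ℕtoℚ n ℚ.* (+ 1 ℚ./ n) ≡ 1ℚ
ℕtoℚ-*-inverse (suc n) =
  trans (cong₂ ℚ._*_ (ℕtoℚ≡mkℚ (suc n)) (ℚ.normalize-coprime (1-coprimeTo (suc n))))
        (ℚ.*-inverseʳ (mkℚ (+ suc n) 0 (coprime-sym (1-coprimeTo (suc n)))))

ℚ∑-ℕtoℚ : {A : Set} (l : List A) (f : A → ℕ) → ℚ∑.∑ l (ℕtoℚ ∘ f) ≡ ℕtoℚ (∑ l f)
ℚ∑-ℕtoℚ []      f = refl
ℚ∑-ℕtoℚ (u ∷ l) f = trans (cong (ℕtoℚ (f u) ℚ.+_) (ℚ∑-ℕtoℚ l f)) (sym (ℕtoℚ-+ (f u) (∑ l f)))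

ℚ∑-const : {A : Set} (l : List A) (q : ℚ) → ℚ∑.∑ l (λ _ → q) ≡ ℕtoℚ (length l) ℚ.* q
ℚ∑-const []      q = sym (ℚ.*-zeroˡ q)
ℚ∑-const (u ∷ l) q = begin
    q ℚ.+ ℚ∑.∑ l (λ _ → q)                ≡⟨ cong₂ ℚ._+_ (sym (ℚ.*-identityˡ q)) (ℚ∑-const l q) ⟩
    1ℚ ℚ.* q ℚ.+ ℕtoℚ (length l) ℚ.* q   ≡⟨ sym (ℚ.*-distribʳ-+ q 1ℚ (ℕtoℚ (length l))) ⟩
    (1ℚ ℚ.+ ℕtoℚ (length l)) ℚ.* q       ≡⟨ cong (ℚ._* q) (sym (ℕtoℚ-+ 1 (length l))) ⟩
    ℕtoℚ (suc (length l)) ℚ.* q          ∎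
  where open ≡-Reasoning

module _ {a d : ℕ} (μ : J a d → ℚ) where

  E-+ : (f g : J a d → ℕ) → E μ (λ I → f I + g I) ≡ E μ f ℚ.+ E μ g
  E-+ f g = trans
    (ℚ∑.∑-cong (ideals a d) λ I →
      trans (cong (μ I ℚ.*_) (ℕtoℚ-+ (f I) (g I))) (ℚ.*-distribˡ-+ (μ I) (ℕtoℚ (f I)) (ℕtoℚ (g I))))
    (ℚ∑.∑-distrib-+ (ideals a d) (λ I → μ I ℚ.* ℕtoℚ (f I)) (λ I → μ I ℚ.* ℕtoℚ (g I)))

  E-*ˡ : (k : ℕ) (f : J a d → ℕ) → E μ (λ I → k * f I) ≡ ℕtoℚ k ℚ.* E μ f
  E-*ˡ k f = trans
    (ℚ∑.∑-cong (ideals a d) λ I →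
      trans (cong (μ I ℚ.*_) (ℕtoℚ-* k (f I))) (x∙yz≈y∙xz (μ I) (ℕtoℚ k) (ℕtoℚ (f I))))
    (ℚ∑.∑-distribˡ-* (ideals a d) (ℕtoℚ k) (λ I → μ I ℚ.* ℕtoℚ (f I)))

  E-const : (k : ℕ) → E μ (λ _ → k) ≡ ℕtoℚ k ℚ.* sumJ μ
  E-const k = trans (ℚ∑.∑-cong (ideals a d) (λ I → ℚ.*-comm (μ I) (ℕtoℚ k)))
                    (ℚ∑.∑-distribˡ-* (ideals a d) (ℕtoℚ k) μ)

  E-∑ : {A : Set} (l : List A) (g : A → J a d → ℕ) →
        E μ (λ I → ∑ l (λ u → g u I)) ≡ ℚ∑.∑ l (λ u → E μ (g u))
  E-∑ []      g = trans (E-const 0) (ℚ.*-zeroˡ (sumJ μ))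
  E-∑ (u ∷ l) g =
    trans (E-+ (g u) (λ I → ∑ l (λ u → g u I))) (cong (E μ (g u) ℚ.+_) (E-∑ l g))

  toggle-identity⇒expectation :
    (k n : ℕ) (c : Elem a d → ℕ) (f : J a d → ℕ) →
    (∀ I → k * f I + ∑ (elems a d) (λ p → c p * Tplus p I)
         ≡ n + ∑ (elems a d) (λ p → c p * Tminus p I)) →
    sumJ μ ≡ 1ℚ → IsToggleSymmetric μ → ℕtoℚ k ℚ.* E μ f ≡ ℕtoℚ n
  toggle-identity⇒expectation k n c f identity μ-sum μ-sym =
    trans (∙-cancelʳ (weighted Tplus) (ℕtoℚ k ℚ.* E μ f) (ℕtoℚ n ℚ.* 1ℚ) (begin
      ℕtoℚ k ℚ.* E μ f ℚ.+ weighted Tplus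
    ≡⟨ sym (expand k f Tplus) ⟩
      E μ (λ I → k * f I + ∑ (elems a d) (λ p → c p * Tplus p I))
    ≡⟨ ℚ∑.∑-cong (ideals a d) (λ I → cong (λ t → μ I ℚ.* ℕtoℚ t)
                                          (trans (identity I) (cong (_+ _) (sym (ℕ.*-identityʳ n))))) ⟩
      E μ (λ I → n * 1 + ∑ (elems a d) (λ p → c p * Tminus p I))
    ≡⟨ expand n (λ _ → 1) Tminus ⟩
      ℕtoℚ n ℚ.* E μ (λ _ → 1) ℚ.+ weighted Tminus
    ≡⟨ cong₂ ℚ._+_ (cong (ℕtoℚ n ℚ.*_) (trans (E-const 1) (trans (ℚ.*-identityˡ (sumJ μ)) μ-sum)))
                   (ℚ∑.∑-cong (elems a d) (λ p → cong (ℕtoℚ (c p) ℚ.*_) (sym (μ-sym p)))) ⟩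
      ℕtoℚ n ℚ.* 1ℚ ℚ.+ weighted Tplus ∎))
    (ℚ.*-identityʳ (ℕtoℚ n))
    where
    open ≡-Reasoning
    weighted : (Elem a d → J a d → ℕ) → ℚ
    weighted T± = ℚ∑.∑ (elems a d) (λ p → ℕtoℚ (c p) ℚ.* E μ (T± p))
    expand : (m : ℕ) (g : J a d → ℕ) (T± : Elem a d → J a d → ℕ) →
             E μ (λ I → m * g I + ∑ (elems a d) (λ p → c p * T± p I))
             ≡ ℕtoℚ m ℚ.* E μ g ℚ.+ weighted T±
    expand m g T± = trans (E-+ (λ I → m * g I) (λ I → ∑ (elems a d) (λ p → c p * T± p I)))
      (cong₂ ℚ._+_ (E-*ˡ m g)
                   (trans (E-∑ (elems a d) (λ p I → c p * T± p I))
                          (ℚ∑.∑-cong (elems a d) (λ p → E-*ˡ (c p) (T± p)))))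

  E-ddeg≡1 : sumJ μ ≡ 1ℚ → IsToggleSymmetric μ → E μ ddeg ≡ 1ℚ
  E-ddeg≡1 μ-sum μ-sym = begin
      E μ ddeg                      ≡⟨ sym (ℚ.*-identityˡ (E μ ddeg)) ⟩
      (½ ℚ.* ℕtoℚ 2) ℚ.* E μ ddeg   ≡⟨ ℚ.*-assoc ½ (ℕtoℚ 2) (E μ ddeg) ⟩
      ½ ℚ.* (ℕtoℚ 2 ℚ.* E μ ddeg)   ≡⟨ cong (½ ℚ.*_) twice-E≡2 ⟩
      ½ ℚ.* ℕtoℚ 2                  ≡⟨⟩
      1ℚ                            ∎
    where
    open ≡-Reasoning
    ½ : ℚ
    ½ = + 1 ℚ./ 2
    twice-E≡2 : ℕtoℚ 2 ℚ.* E μ ddeg ≡ ℕtoℚ 2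
    twice-E≡2 = toggle-identity⇒expectation 2 2 c⁺ ddeg ddeg-toggle-identity μ-sum μ-sym

module _ {a d : ℕ} where

  private
    |J| : ℕ
    |J| = length (ideals a d)

    1/|J| : ℚ
    1/|J| = ℚ._/_ (+ 1) |J| {{idealsNonZero {a} {d}}}

  uni-sum : sumJ {a} {d} uni ≡ 1ℚ
  uni-sum = trans (ℚ∑-const (ideals a d) 1/|J|) (ℕtoℚ-*-inverse |J| {{idealsNonZero {a} {d}}})

  E-uni : (f : J a d → ℕ) → E {a} {d} uni f ≡ 1/|J| ℚ.* ℕtoℚ (∑ (ideals a d) f)
  E-uni f = trans (ℚ∑.∑-distribˡ-* (ideals a d) 1/|J| (ℕtoℚ ∘ f))
                  (cong (1/|J| ℚ.*_) (ℚ∑-ℕtoℚ (ideals a d) f))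

  uni-toggleSymmetric : IsToggleSymmetric {a} {d} uni
  uni-toggleSymmetric p = trans (E-uni (Tplus p))
    (trans (cong (λ t → 1/|J| ℚ.* ℕtoℚ t) (∑Tplus≡∑Tminus p)) (sym (E-uni (Tminus p))))

-- The argument does not use a ≥ 1 or d ≥ 1.
proposition5p1 : (a d : ℕ) → a ≥ 1 → d ≥ 1 →
    IsTCDE a d × edgeDensity a d ≡ 1ℚ
proposition5p1 a d _ _ = tcde , density
  where
  density : edgeDensity a d ≡ 1ℚ
  density = E-ddeg≡1 uni (uni-sum {a} {d}) (uni-toggleSymmetric {a} {d})
  tcde : IsTCDE a d
  tcde μ (_ , μ-sum) μ-sym = trans (E-ddeg≡1 μ μ-sum μ-sym) (sym density)
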